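{- Let $\mathfrak g,\mathfrak h$ be Lie algebras, $\upsilon:\mathfrak g\to\operatorname{Der}(\mathfrak h)$ a Lie algebra morphism and $\phi:\mathfrak g\to\mathfrak h$ a crossed morphism relative to $\upsilon$. Define $M:\mathfrak g\to\operatorname{End}_{\mathbb K}(\mathcal U(\mathfrak h))$ by $M(x)=\upsilon_x+\sigma_x$, where $\upsilon_x$ also denotes the unique extension of $\upsilon_x$ to a derivation of the associative algebra $\mathcal U(\mathfrak h)$ and $\sigma_x(X)=\phi(x)\cdot X$ for $X\in\mathcal U(\mathfrak h)$. Then for all $x,y\in\mathfrak g$, $$M([x,y]_{\mathfrak g})=M(x)\circ M(y)-M(y)\circ M(x),$$ so that $M$ makes $\mathcal U(\mathfrak h)$ a $\mathfrak g$-module.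
   Context: $\mathbb K$ is a field of characteristic zero; $\mathcal U(\mathfrak h)$ is the universal enveloping algebra of $\mathfrak h$ and $\operatorname{Der}(\mathfrak h)$ the Lie algebra of derivations of $\mathfrak h$. A crossed morphism relative to $\upsilon$ is a linear map $\phi:\mathfrak g\to\mathfrak h$ satisfying $\phi([x,y]_{\mathfrak g})=\upsilon_x(\phi(y))-\upsilon_y(\phi(x))+[\phi(x),\phi(y)]_{\mathfrak h}$ for all $x,y\in\mathfrak g$. -}

module Defs where

open import Level using (Level; _⊔_; suc)
open import Data.Nat using (ℕ)
open import Data.Product using (Σ; ∃; _×_)
open import Relation.Binary.PropositionalEquality using (_≡_)
open import Relation.Nullary using (¬_)
open import Algebra.Core using (Op₂)
open import Algebra.Bundles using (CommutativeRing; Semiring)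
open import Algebra.Module.Bundles using (Module)
import Algebra.Definitions.RawSemiring as RawSemiringDefs

private
  variable
    k ℓk m ℓm n ℓn a ℓa b ℓb : Level

record IsFieldOfCharZero (K : CommutativeRing k ℓk) : Set (k ⊔ ℓk) where
  open CommutativeRing K
  open RawSemiringDefs (Semiring.rawSemiring semiring) using () renaming (_×_ to _·ℕ_)
  field
    1≉0      : ¬ (1# ≈ 0#)
    inverse  : ∀ x → ¬ (x ≈ 0#) → ∃ λ y → x * y ≈ 1#
    charZero : ∀ (j : ℕ) → (j ·ℕ 1#) ≈ 0# → j ≡ 0

module _ {K : CommutativeRing k ℓk} where
  open CommutativeRing K renaming (Carrier to 𝕂)

  record IsLinear (V : Module K m ℓm) (W : Module K n ℓn)
                  (f : Module.Carrierᴹ V → Module.Carrierᴹ W)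
                  : Set (k ⊔ m ⊔ ℓm ⊔ ℓn) where
    private
      module V = Module V
      module W = Module W
    field
      cong  : ∀ {x y} → x V.≈ᴹ y → f x W.≈ᴹ f y
      additive : ∀ x y → f (x V.+ᴹ y) W.≈ᴹ f x W.+ᴹ f y
      homogeneous : ∀ (c : 𝕂) x → f (c V.*ₗ x) W.≈ᴹ c W.*ₗ f x

  record LieAlgebra m ℓm : Set (k ⊔ ℓk ⊔ suc (m ⊔ ℓm)) where
    field
      vectorSpace : Module K m ℓm
    open Module vectorSpace public
    infixl 6 _-ᴹ_
    _-ᴹ_ : Carrierᴹ → Carrierᴹ → Carrierᴹ
    x -ᴹ y = x +ᴹ (-ᴹ y)
    field
      [_,_]        : Op₂ Carrierᴹ
      bracket-cong : ∀ {x x′ y y′} → x ≈ᴹ x′ → y ≈ᴹ y′ → [ x , y ] ≈ᴹ [ x′ , y′ ]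
      bracket-+ˡ   : ∀ x y z → [ x +ᴹ y , z ] ≈ᴹ [ x , z ] +ᴹ [ y , z ]
      bracket-+ʳ   : ∀ x y z → [ x , y +ᴹ z ] ≈ᴹ [ x , y ] +ᴹ [ x , z ]
      bracket-*ˡ   : ∀ (c : 𝕂) x y → [ c *ₗ x , y ] ≈ᴹ c *ₗ [ x , y ]
      bracket-*ʳ   : ∀ (c : 𝕂) x y → [ x , c *ₗ y ] ≈ᴹ c *ₗ [ x , y ]
      alternating  : ∀ x → [ x , x ] ≈ᴹ 0ᴹ
      jacobi       : ∀ x y z →
                     [ x , [ y , z ] ] +ᴹ [ y , [ z , x ] ] +ᴹ [ z , [ x , y ] ] ≈ᴹ 0ᴹ

  record AssocAlgebra a ℓa : Set (k ⊔ ℓk ⊔ suc (a ⊔ ℓa)) where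
    field
      vectorSpace : Module K a ℓa
    open Module vectorSpace public
    infixl 6 _-ᴹ_
    _-ᴹ_ : Carrierᴹ → Carrierᴹ → Carrierᴹ
    x -ᴹ y = x +ᴹ (-ᴹ y)
    infixl 7 _·_
    field
      _·_     : Op₂ Carrierᴹ
      1ᴬ      : Carrierᴹ
      ·-cong  : ∀ {x x′ y y′} → x ≈ᴹ x′ → y ≈ᴹ y′ → x · y ≈ᴹ x′ · y′
      ·-assoc : ∀ x y z → (x · y) · z ≈ᴹ x · (y · z)
      ·-identityˡ : ∀ x → 1ᴬ · x ≈ᴹ x
      ·-identityʳ : ∀ x → x · 1ᴬ ≈ᴹ x
      ·-+ˡ    : ∀ x y z → (x +ᴹ y) · z ≈ᴹ x · z +ᴹ y · z
      ·-+ʳ    : ∀ x y z → x · (y +ᴹ z) ≈ᴹ x · y +ᴹ x · z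
      ·-*ˡ    : ∀ (c : 𝕂) x y → (c *ₗ x) · y ≈ᴹ c *ₗ (x · y)
      ·-*ʳ    : ∀ (c : 𝕂) x y → x · (c *ₗ y) ≈ᴹ c *ₗ (x · y)

  record IsLieDerivation (𝔥 : LieAlgebra m ℓm)
                         (D : LieAlgebra.Carrierᴹ 𝔥 → LieAlgebra.Carrierᴹ 𝔥)
                         : Set (k ⊔ m ⊔ ℓm) where
    open LieAlgebra 𝔥
    field
      linear  : IsLinear vectorSpace vectorSpace D
      leibniz : ∀ x y → D [ x , y ] ≈ᴹ [ D x , y ] +ᴹ [ x , D y ]

  record IsAlgDerivation (A : AssocAlgebra a ℓa)
                         (D : AssocAlgebra.Carrierᴹ A → AssocAlgebra.Carrierᴹ A)
                         : Set (k ⊔ a ⊔ ℓa) where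
    open AssocAlgebra A
    field
      linear  : IsLinear vectorSpace vectorSpace D
      leibniz : ∀ x y → D (x · y) ≈ᴹ D x · y +ᴹ x · D y

  record IsAlgHom (A : AssocAlgebra a ℓa) (B : AssocAlgebra b ℓb)
                  (F : AssocAlgebra.Carrierᴹ A → AssocAlgebra.Carrierᴹ B)
                  : Set (k ⊔ a ⊔ ℓa ⊔ ℓb) where
    private
      module A = AssocAlgebra A
      module B = AssocAlgebra B
    field
      linear   : IsLinear A.vectorSpace B.vectorSpace F
      mult     : ∀ x y → F (x A.· y) B.≈ᴹ F x B.· F y
      unit     : F A.1ᴬ B.≈ᴹ B.1ᴬ

  -- Universal enveloping algebra 𝒰(𝔥), given by its universal property
  -- (with respect to unital associative 𝕂-algebras of the same universe
  -- levels as 𝒰(𝔥)).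

  record UniversalEnvelope (𝔥 : LieAlgebra m ℓm) a ℓa
                           : Set (k ⊔ ℓk ⊔ m ⊔ ℓm ⊔ suc (a ⊔ ℓa)) where
    private
      module H = LieAlgebra 𝔥
    field
      algebra : AssocAlgebra a ℓa
    open AssocAlgebra algebra public
    field
      ι         : H.Carrierᴹ → Carrierᴹ
      ι-linear  : IsLinear H.vectorSpace vectorSpace ι
      ι-bracket : ∀ x y → ι H.[ x , y ] ≈ᴹ ι x · ι y -ᴹ ι y · ι x
      universal :
        (B : AssocAlgebra a ℓa) (f : H.Carrierᴹ → AssocAlgebra.Carrierᴹ B) →
        IsLinear H.vectorSpace (AssocAlgebra.vectorSpace B) f →
        (∀ x y → AssocAlgebra._≈ᴹ_ B (f H.[ x , y ])
                   (AssocAlgebra._-ᴹ_ B (AssocAlgebra._·_ B (f x) (f y))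
                                        (AssocAlgebra._·_ B (f y) (f x)))) →
        Σ (Carrierᴹ → AssocAlgebra.Carrierᴹ B) λ F →
          IsAlgHom algebra B F × (∀ x → AssocAlgebra._≈ᴹ_ B (F (ι x)) (f x))
      unique :
        (B : AssocAlgebra a ℓa) (F F′ : Carrierᴹ → AssocAlgebra.Carrierᴹ B) →
        IsAlgHom algebra B F → IsAlgHom algebra B F′ →
        (∀ x → AssocAlgebra._≈ᴹ_ B (F (ι x)) (F′ (ι x))) →
        ∀ X → AssocAlgebra._≈ᴹ_ B (F X) (F′ X)

  record IsLieMorphismToDer (𝔤 : LieAlgebra m ℓm) (𝔥 : LieAlgebra n ℓn)
         (υ : LieAlgebra.Carrierᴹ 𝔤 → LieAlgebra.Carrierᴹ 𝔥 → LieAlgebra.Carrierᴹ 𝔥)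
         : Set (k ⊔ m ⊔ ℓm ⊔ n ⊔ ℓn) where
    private
      module G = LieAlgebra 𝔤
      module H = LieAlgebra 𝔥
    field
      derivation  : ∀ x → IsLieDerivation 𝔥 (υ x)
      cong        : ∀ {x x′} → x G.≈ᴹ x′ → ∀ v → υ x v H.≈ᴹ υ x′ v
      additive    : ∀ x y v → υ (x G.+ᴹ y) v H.≈ᴹ υ x v H.+ᴹ υ y v
      homogeneous : ∀ (c : 𝕂) x v → υ (c G.*ₗ x) v H.≈ᴹ c H.*ₗ υ x v
      bracket     : ∀ x y v → υ G.[ x , y ] v H.≈ᴹ υ x (υ y v) H.-ᴹ υ y (υ x v)

  record IsCrossedMorphism (𝔤 : LieAlgebra m ℓm) (𝔥 : LieAlgebra n ℓn)
         (υ : LieAlgebra.Carrierᴹ 𝔤 → LieAlgebra.Carrierᴹ 𝔥 → LieAlgebra.Carrierᴹ 𝔥)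
         (φ : LieAlgebra.Carrierᴹ 𝔤 → LieAlgebra.Carrierᴹ 𝔥)
         : Set (k ⊔ m ⊔ ℓm ⊔ n ⊔ ℓn) where
    private
      module G = LieAlgebra 𝔤
      module H = LieAlgebra 𝔥
    field
      linear  : IsLinear G.vectorSpace H.vectorSpace φ
      crossed : ∀ x y →
        φ G.[ x , y ] H.≈ᴹ υ x (φ y) H.-ᴹ υ y (φ x) H.+ᴹ H.[ φ x , φ y ]

  record IsLieModule (𝔤 : LieAlgebra m ℓm) (V : Module K a ℓa)
         (M : LieAlgebra.Carrierᴹ 𝔤 → Module.Carrierᴹ V → Module.Carrierᴹ V)
         : Set (k ⊔ m ⊔ ℓm ⊔ a ⊔ ℓa) where
    private
      module G = LieAlgebra 𝔤
      module V = Module V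
    field
      endo        : ∀ x → IsLinear V V (M x)
      cong        : ∀ {x x′} → x G.≈ᴹ x′ → ∀ v → M x v V.≈ᴹ M x′ v
      additive    : ∀ x y v → M (x G.+ᴹ y) v V.≈ᴹ M x v V.+ᴹ M y v
      homogeneous : ∀ (c : 𝕂) x v → M (c G.*ₗ x) v V.≈ᴹ c V.*ₗ M x v
      bracket     : ∀ x y v →
        M G.[ x , y ] v V.≈ᴹ M x (M y v) V.+ᴹ (V.-ᴹ M y (M x v))

  -- The map M(x) = ῡ_x + σ_x on 𝒰(𝔥), where ῡ_x is the extension of υ_x
  -- to a derivation of 𝒰(𝔥) and σ_x(X) = φ(x)·X.

  M-action : (𝔤 : LieAlgebra m ℓm) {𝔥 : LieAlgebra n ℓn}
             (U : UniversalEnvelope 𝔥 a ℓa) →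
             (φ : LieAlgebra.Carrierᴹ 𝔤 → LieAlgebra.Carrierᴹ 𝔥) →
             (ῡ : LieAlgebra.Carrierᴹ 𝔤 → UniversalEnvelope.Carrierᴹ U →
                  UniversalEnvelope.Carrierᴹ U) →
             LieAlgebra.Carrierᴹ 𝔤 → UniversalEnvelope.Carrierᴹ U →
             UniversalEnvelope.Carrierᴹ U
  M-action 𝔤 U φ ῡ x X = ῡ x X +ᴹ (ι (φ x) · X)
    where open UniversalEnvelope U

-- The extension ῡ_x of υ_x to a derivation of 𝒰(𝔥) is unique, since a
-- derivation D amounts to the algebra morphism X ↦ X + D(X) ε into the dual
-- numbers 𝒰(𝔥)[ε], and such morphisms are determined on the generators ι(𝔥).
-- Hence x ↦ ῡ_x is linear and preserves brackets because υ does. In any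
-- associative algebra, for derivations D, D′ and elements p, q,
--   [D + L_p, D′ + L_q] = [D, D′] + L_(D q − D′ p + [p, q]),
-- where L_p is left multiplication by p; for D = ῡ_x, D′ = ῡ_y and p, q the
-- images of φ(x), φ(y) in 𝒰(𝔥), the crossed-morphism identity says that the
-- last subscript is the image of φ([x, y]). Nothing uses that 𝕂 is a field
-- of characteristic zero.

module Submission where

open import Defs
open import Level using (Level)
open import Algebra.Bundles using (CommutativeRing; CommutativeMonoid)
open import Algebra.Module.Bundles using (Module)
open import Data.Product using (_,_; proj₂)
import Algebra.Module.Construct.DirectProduct as DirectProduct
import Algebra.Properties.AbelianGroup as AbelianGroupProperties
import Algebra.Properties.CommutativeSemigroup as CommutativeSemigroupProperties
import Relation.Binary.Reasoning.Setoid as SetoidReasoning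

private
  variable
    k ℓk m ℓm n ℓn a ℓa : Level

module Subtraction {K : CommutativeRing k ℓk} (V : Module K m ℓm) where
  open Module V
  open AbelianGroupProperties +ᴹ-abelianGroup
  open CommutativeSemigroupProperties
    (CommutativeMonoid.commutativeSemigroup +ᴹ-commutativeMonoid)
  open SetoidReasoning ≈ᴹ-setoid

  infixl 6 _-ᴹ_
  _-ᴹ_ : Carrierᴹ → Carrierᴹ → Carrierᴹ
  x -ᴹ y = x +ᴹ (-ᴹ y)

  +ᴹ-interchange : ∀ w x y z → (w +ᴹ x) +ᴹ (y +ᴹ z) ≈ᴹ (w +ᴹ y) +ᴹ (x +ᴹ z)
  +ᴹ-interchange = interchange

  +ᴹ-cross : ∀ w x y z → (w +ᴹ x) +ᴹ (y +ᴹ z) ≈ᴹ (w +ᴹ z) +ᴹ (x +ᴹ y)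
  +ᴹ-cross w x y z =
    ≈ᴹ-trans (+ᴹ-congˡ (+ᴹ-comm y z)) (interchange w x z y)

  -ᴹ-interchange : ∀ w x y z → (w +ᴹ x) -ᴹ (y +ᴹ z) ≈ᴹ (w -ᴹ y) +ᴹ (x -ᴹ z)
  -ᴹ-interchange w x y z =
    ≈ᴹ-trans (+ᴹ-congˡ (≈ᴹ-sym (⁻¹-∙-comm y z))) (interchange w x (-ᴹ y) (-ᴹ z))

  +ᴹ-cancelʳ-sub : ∀ x y z → (x +ᴹ z) -ᴹ (y +ᴹ z) ≈ᴹ x -ᴹ y
  +ᴹ-cancelʳ-sub x y z = begin
    (x +ᴹ z) -ᴹ (y +ᴹ z)   ≈⟨ -ᴹ-interchange x z y z ⟩
    (x -ᴹ y) +ᴹ (z -ᴹ z)   ≈⟨ +ᴹ-congˡ (-ᴹ‿inverseʳ z) ⟩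
    (x -ᴹ y) +ᴹ 0ᴹ         ≈⟨ +ᴹ-identityʳ (x -ᴹ y) ⟩
    x -ᴹ y                 ∎

  +ᴹ-sub-cancelʳ : ∀ x y → (x +ᴹ y) -ᴹ y ≈ᴹ x
  +ᴹ-sub-cancelʳ x y = //-rightDividesʳ y x

  -ᴹ-anticomm : ∀ x y → -ᴹ (x -ᴹ y) ≈ᴹ y -ᴹ x
  -ᴹ-anticomm = ⁻¹-anti-homo‿-

  x+x≈x⇒x≈0 : ∀ x → x +ᴹ x ≈ᴹ x → x ≈ᴹ 0ᴹ
  x+x≈x⇒x≈0 x = identityʳ-unique x x

  x+y≈0⇒y≈-x : ∀ x y → x +ᴹ y ≈ᴹ 0ᴹ → y ≈ᴹ -ᴹ x
  x+y≈0⇒y≈-x = inverseʳ-unique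

module LinearMapProperties {K : CommutativeRing k ℓk}
    {V : Module K m ℓm} {W : Module K n ℓn}
    {f : Module.Carrierᴹ V → Module.Carrierᴹ W} (f-linear : IsLinear V W f) where
  private
    module V = Module V
  open Module W
  open Subtraction W
  open IsLinear f-linear
  open SetoidReasoning ≈ᴹ-setoid

  0ᴹ-homo : f V.0ᴹ ≈ᴹ 0ᴹ
  0ᴹ-homo = x+x≈x⇒x≈0 (f V.0ᴹ)
    (≈ᴹ-trans (≈ᴹ-sym (additive V.0ᴹ V.0ᴹ)) (cong (V.+ᴹ-identityʳ V.0ᴹ)))

  -ᴹ-homo : ∀ x → f (V.-ᴹ x) ≈ᴹ -ᴹ f x
  -ᴹ-homo x = x+y≈0⇒y≈-x (f x) (f (V.-ᴹ x)) (begin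
    f x +ᴹ f (V.-ᴹ x)   ≈⟨ additive x (V.-ᴹ x) ⟨
    f (x V.+ᴹ V.-ᴹ x)   ≈⟨ cong (V.-ᴹ‿inverseʳ x) ⟩
    f V.0ᴹ              ≈⟨ 0ᴹ-homo ⟩
    0ᴹ                  ∎)

  sub-homo : ∀ x y → f (x V.+ᴹ V.-ᴹ y) ≈ᴹ f x -ᴹ f y
  sub-homo x y = ≈ᴹ-trans (additive x (V.-ᴹ y)) (+ᴹ-congˡ (-ᴹ-homo y))

∘-linear : {K : CommutativeRing k ℓk}
           {U : Module K a ℓa} {V : Module K m ℓm} {W : Module K n ℓn}
           {f : Module.Carrierᴹ V → Module.Carrierᴹ W}
           {g : Module.Carrierᴹ U → Module.Carrierᴹ V} →
           IsLinear V W f → IsLinear U V g → IsLinear U W (λ x → f (g x))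
∘-linear {W = W} f-linear g-linear = record
  { cong        = λ x≈y → f.cong (g.cong x≈y)
  ; additive    = λ x y → ≈ᴹ-trans (f.cong (g.additive x y)) (f.additive _ _)
  ; homogeneous = λ c x → ≈ᴹ-trans (f.cong (g.homogeneous c x)) (f.homogeneous c _)
  }
  where
  open Module W using (≈ᴹ-trans)
  module f = IsLinear f-linear
  module g = IsLinear g-linear

module Endomaps {K : CommutativeRing k ℓk} (V : Module K m ℓm) where
  open CommutativeRing K using (_*_; *-comm) renaming (Carrier to 𝕂)
  open Module V
  open Subtraction V
  open SetoidReasoning ≈ᴹ-setoid

  Endo : Set m
  Endo = Carrierᴹ → Carrierᴹ

  IsEndo : Endo → Set _
  IsEndo = IsLinear V V

  infixl 6 _⊕_
  infixr 7 _⊙_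

  _⊕_ : Endo → Endo → Endo
  (F ⊕ G) x = F x +ᴹ G x

  _⊙_ : 𝕂 → Endo → Endo
  (c ⊙ F) x = c *ₗ F x

  ⟦_,_⟧ : Endo → Endo → Endo
  ⟦ F , G ⟧ x = F (G x) -ᴹ G (F x)

  *ₗ-linear : ∀ c → IsEndo (c *ₗ_)
  *ₗ-linear c = record
    { cong        = *ₗ-congˡ
    ; additive    = *ₗ-distribˡ c
    ; homogeneous = λ c′ x → begin
        c *ₗ c′ *ₗ x    ≈⟨ *ₗ-assoc c c′ x ⟨
        (c * c′) *ₗ x   ≈⟨ *ₗ-congʳ (*-comm c c′) ⟩
        (c′ * c) *ₗ x   ≈⟨ *ₗ-assoc c′ c x ⟩
        c′ *ₗ c *ₗ x    ∎
    }

  ⊕-linear : ∀ {F G} → IsEndo F → IsEndo G → IsEndo (F ⊕ G)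
  ⊕-linear F-linear G-linear = record
    { cong        = λ x≈y → +ᴹ-cong (F.cong x≈y) (G.cong x≈y)
    ; additive    = λ x y → ≈ᴹ-trans (+ᴹ-cong (F.additive x y) (G.additive x y))
                                     (+ᴹ-interchange _ _ _ _)
    ; homogeneous = λ c x → ≈ᴹ-trans (+ᴹ-cong (F.homogeneous c x) (G.homogeneous c x))
                                     (≈ᴹ-sym (*ₗ-distribˡ c _ _))
    }
    where
    module F = IsLinear F-linear
    module G = IsLinear G-linear

  ⊙-linear : ∀ c {F} → IsEndo F → IsEndo (c ⊙ F)
  ⊙-linear c F-linear = ∘-linear (*ₗ-linear c) F-linear

  ⟦⟧-linear : ∀ {F G} → IsEndo F → IsEndo G → IsEndo ⟦ F , G ⟧
  ⟦⟧-linear {F} {G} F-linear G-linear = record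
    { cong        = λ x≈y → +ᴹ-cong (FG.cong x≈y) (-ᴹ‿cong (GF.cong x≈y))
    ; additive    = λ x y → ≈ᴹ-trans (+ᴹ-cong (FG.additive x y) (-ᴹ‿cong (GF.additive x y)))
                                     (-ᴹ-interchange _ _ _ _)
    ; homogeneous = λ c x → begin
        F (G (c *ₗ x)) -ᴹ G (F (c *ₗ x))
          ≈⟨ +ᴹ-cong (FG.homogeneous c x) (-ᴹ‿cong (GF.homogeneous c x)) ⟩
        c *ₗ F (G x) -ᴹ c *ₗ G (F x)
          ≈⟨ LinearMapProperties.sub-homo (*ₗ-linear c) _ _ ⟨
        c *ₗ (F (G x) -ᴹ G (F x)) ∎
    }
    where
    module FG = IsLinear (∘-linear F-linear G-linear)
    module GF = IsLinear (∘-linear G-linear F-linear)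

  ⟦⟧-distribʳ-⊕ : ∀ {G} → IsEndo G → ∀ F F′ x →
                  ⟦ F ⊕ F′ , G ⟧ x ≈ᴹ (⟦ F , G ⟧ ⊕ ⟦ F′ , G ⟧) x
  ⟦⟧-distribʳ-⊕ G-linear F F′ x = ≈ᴹ-trans
    (+ᴹ-congˡ (-ᴹ‿cong (IsLinear.additive G-linear (F x) (F′ x))))
    (-ᴹ-interchange _ _ _ _)

  ⟦⟧-distribˡ-⊕ : ∀ {F} → IsEndo F → ∀ G G′ x →
                  ⟦ F , G ⊕ G′ ⟧ x ≈ᴹ (⟦ F , G ⟧ ⊕ ⟦ F , G′ ⟧) x
  ⟦⟧-distribˡ-⊕ F-linear G G′ x = ≈ᴹ-trans
    (+ᴹ-congʳ (IsLinear.additive F-linear (G x) (G′ x)))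
    (-ᴹ-interchange _ _ _ _)

  ⟦⟧-anticomm : ∀ F G x → ⟦ F , G ⟧ x ≈ᴹ -ᴹ ⟦ G , F ⟧ x
  ⟦⟧-anticomm F G x = ≈ᴹ-sym (-ᴹ-anticomm (G (F x)) (F (G x)))

module AssocAlgebraProperties {K : CommutativeRing k ℓk} (A : AssocAlgebra {K = K} a ℓa) where
  open AssocAlgebra A
  open Subtraction vectorSpace hiding (_-ᴹ_)
  open Endomaps vectorSpace
  open SetoidReasoning ≈ᴹ-setoid

  module Derivation {D : Endo} (D-derivation : IsAlgDerivation A D) where
    open IsAlgDerivation D-derivation public
    open IsLinear linear public

  L : Carrierᴹ → Endo
  L p X = p · X

  L-linear : ∀ p → IsEndo (L p)
  L-linear p = record
    { cong        = ·-cong ≈ᴹ-refl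
    ; additive    = ·-+ʳ p
    ; homogeneous = λ c X → ·-*ʳ c p X
    }

  R-linear : ∀ X → IsEndo (_· X)
  R-linear X = record
    { cong        = λ p≈q → ·-cong p≈q ≈ᴹ-refl
    ; additive    = λ p q → ·-+ˡ p q X
    ; homogeneous = λ c p → ·-*ˡ c p X
    }

  derivation-1ᴬ : ∀ {D} → IsAlgDerivation A D → D 1ᴬ ≈ᴹ 0ᴹ
  derivation-1ᴬ {D} D-derivation = x+x≈x⇒x≈0 (D 1ᴬ) (begin
    D 1ᴬ +ᴹ D 1ᴬ            ≈⟨ +ᴹ-cong (·-identityʳ (D 1ᴬ)) (·-identityˡ (D 1ᴬ)) ⟨
    D 1ᴬ · 1ᴬ +ᴹ 1ᴬ · D 1ᴬ  ≈⟨ leibniz 1ᴬ 1ᴬ ⟨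
    D (1ᴬ · 1ᴬ)             ≈⟨ IsLinear.cong linear (·-identityˡ 1ᴬ) ⟩
    D 1ᴬ                    ∎)
    where open IsAlgDerivation D-derivation

  -- (x , y) stands for x + y ε, where ε² = 0.
  dualNumbers : AssocAlgebra {K = K} a ℓa
  dualNumbers = record
    { vectorSpace = DirectProduct.⟨module⟩ vectorSpace vectorSpace
    ; _·_         = _·ε_
    ; 1ᴬ          = 1ᴬ , 0ᴹ
    ; ·-cong      = λ (x≈x′ , y≈y′) (u≈u′ , v≈v′) →
        ·-cong x≈x′ u≈u′ , +ᴹ-cong (·-cong x≈x′ v≈v′) (·-cong y≈y′ u≈u′)
    ; ·-assoc     = ·ε-assoc
    ; ·-identityˡ = λ (x , y) → ·-identityˡ x ,
        ≈ᴹ-trans (+ᴹ-cong (·-identityˡ y) (0·X≈0 x)) (+ᴹ-identityʳ y)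
    ; ·-identityʳ = λ (x , y) → ·-identityʳ x ,
        ≈ᴹ-trans (+ᴹ-cong (X·0≈0 x) (·-identityʳ y)) (+ᴹ-identityˡ y)
    ; ·-+ˡ        = λ (x , y) (x′ , y′) (u , v) → ·-+ˡ x x′ u ,
        ≈ᴹ-trans (+ᴹ-cong (·-+ˡ x x′ v) (·-+ˡ y y′ u)) (+ᴹ-interchange _ _ _ _)
    ; ·-+ʳ        = λ (u , v) (x , y) (x′ , y′) → ·-+ʳ u x x′ ,
        ≈ᴹ-trans (+ᴹ-cong (·-+ʳ u y y′) (·-+ʳ v x x′)) (+ᴹ-interchange _ _ _ _)
    ; ·-*ˡ        = λ c (x , y) (u , v) → ·-*ˡ c x u ,
        ≈ᴹ-trans (+ᴹ-cong (·-*ˡ c x v) (·-*ˡ c y u)) (≈ᴹ-sym (*ₗ-distribˡ c _ _))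
    ; ·-*ʳ        = λ c (x , y) (u , v) → ·-*ʳ c x u ,
        ≈ᴹ-trans (+ᴹ-cong (·-*ʳ c x v) (·-*ʳ c y u)) (≈ᴹ-sym (*ₗ-distribˡ c _ _))
    }
    where
    _·ε_ : _ → _ → _
    (x , y) ·ε (u , v) = x · u , x · v +ᴹ y · u

    0·X≈0 : ∀ X → 0ᴹ · X ≈ᴹ 0ᴹ
    0·X≈0 X = LinearMapProperties.0ᴹ-homo (R-linear X)

    X·0≈0 : ∀ X → X · 0ᴹ ≈ᴹ 0ᴹ
    X·0≈0 X = LinearMapProperties.0ᴹ-homo (L-linear X)

    ·ε-assoc : ∀ p q r → _
    ·ε-assoc (x , y) (u , v) (w , z) = ·-assoc x u w , (begin
      (x · u) · z +ᴹ (x · v +ᴹ y · u) · w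
        ≈⟨ +ᴹ-cong (·-assoc x u z) (·-+ˡ _ _ w) ⟩
      x · (u · z) +ᴹ ((x · v) · w +ᴹ (y · u) · w)
        ≈⟨ +ᴹ-congˡ (+ᴹ-cong (·-assoc x v w) (·-assoc y u w)) ⟩
      x · (u · z) +ᴹ (x · (v · w) +ᴹ y · (u · w))
        ≈⟨ +ᴹ-assoc _ _ _ ⟨
      (x · (u · z) +ᴹ x · (v · w)) +ᴹ y · (u · w)
        ≈⟨ +ᴹ-congʳ (·-+ʳ x _ _) ⟨
      x · (u · z +ᴹ v · w) +ᴹ y · (u · w) ∎)

  graph-isAlgHom : ∀ {D} → IsAlgDerivation A D → IsAlgHom A dualNumbers (λ X → X , D X)
  graph-isAlgHom D-derivation = record
    { linear = record
      { cong        = λ X≈Y → X≈Y , cong X≈Y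
      ; additive    = λ X Y → ≈ᴹ-refl , additive X Y
      ; homogeneous = λ c X → ≈ᴹ-refl , homogeneous c X
      }
    ; mult = λ X Y → ≈ᴹ-refl , ≈ᴹ-trans (leibniz X Y) (+ᴹ-comm _ _)
    ; unit = ≈ᴹ-refl , derivation-1ᴬ D-derivation
    }
    where open Derivation D-derivation

  ⊕-derivation : ∀ {D D′} → IsAlgDerivation A D → IsAlgDerivation A D′ →
                 IsAlgDerivation A (D ⊕ D′)
  ⊕-derivation {D} {D′} D-derivation D′-derivation = record
    { linear  = ⊕-linear D.linear D′.linear
    ; leibniz = λ X Y → begin
        D (X · Y) +ᴹ D′ (X · Y)
          ≈⟨ +ᴹ-cong (D.leibniz X Y) (D′.leibniz X Y) ⟩
        (D X · Y +ᴹ X · D Y) +ᴹ (D′ X · Y +ᴹ X · D′ Y)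
          ≈⟨ +ᴹ-interchange _ _ _ _ ⟩
        (D X · Y +ᴹ D′ X · Y) +ᴹ (X · D Y +ᴹ X · D′ Y)
          ≈⟨ +ᴹ-cong (·-+ˡ _ _ Y) (·-+ʳ X _ _) ⟨
        (D X +ᴹ D′ X) · Y +ᴹ X · (D Y +ᴹ D′ Y) ∎
    }
    where
    module D = Derivation D-derivation
    module D′ = Derivation D′-derivation

  ⊙-derivation : ∀ c {D} → IsAlgDerivation A D → IsAlgDerivation A (c ⊙ D)
  ⊙-derivation c {D} D-derivation = record
    { linear  = ⊙-linear c linear
    ; leibniz = λ X Y → begin
        c *ₗ D (X · Y)                      ≈⟨ *ₗ-congˡ (leibniz X Y) ⟩
        c *ₗ (D X · Y +ᴹ X · D Y)           ≈⟨ *ₗ-distribˡ c _ _ ⟩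
        c *ₗ (D X · Y) +ᴹ c *ₗ (X · D Y)    ≈⟨ +ᴹ-cong (·-*ˡ c _ _) (·-*ʳ c _ _) ⟨
        (c *ₗ D X) · Y +ᴹ X · (c *ₗ D Y)    ∎
    }
    where open IsAlgDerivation D-derivation

  leibniz-∘ : ∀ {D D′} → IsAlgDerivation A D → IsAlgDerivation A D′ → ∀ X Y →
              D (D′ (X · Y)) ≈ᴹ (D (D′ X) · Y +ᴹ D′ X · D Y) +ᴹ (D X · D′ Y +ᴹ X · D (D′ Y))
  leibniz-∘ {D} {D′} D-derivation D′-derivation X Y = begin
    D (D′ (X · Y))                  ≈⟨ D.cong (D′.leibniz X Y) ⟩
    D (D′ X · Y +ᴹ X · D′ Y)        ≈⟨ D.additive _ _ ⟩
    D (D′ X · Y) +ᴹ D (X · D′ Y)    ≈⟨ +ᴹ-cong (D.leibniz _ _) (D.leibniz _ _) ⟩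
    (D (D′ X) · Y +ᴹ D′ X · D Y) +ᴹ (D X · D′ Y +ᴹ X · D (D′ Y)) ∎
    where
    module D = Derivation D-derivation
    module D′ = Derivation D′-derivation

  ⟦⟧-derivation : ∀ {D D′} → IsAlgDerivation A D → IsAlgDerivation A D′ →
                  IsAlgDerivation A ⟦ D , D′ ⟧
  ⟦⟧-derivation {D} {D′} D-derivation D′-derivation = record
    { linear  = ⟦⟧-linear D.linear D′.linear
    ; leibniz = λ X Y → begin
        D (D′ (X · Y)) -ᴹ D′ (D (X · Y))
          ≈⟨ +ᴹ-cong (leibniz-∘ D-derivation D′-derivation X Y)
                     (-ᴹ‿cong (leibniz-∘ D′-derivation D-derivation X Y)) ⟩
        ((D (D′ X) · Y +ᴹ D′ X · D Y) +ᴹ (D X · D′ Y +ᴹ X · D (D′ Y))) -ᴹ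
        ((D′ (D X) · Y +ᴹ D X · D′ Y) +ᴹ (D′ X · D Y +ᴹ X · D′ (D Y)))
          ≈⟨ +ᴹ-cong (+ᴹ-cross _ _ _ _)
                     (-ᴹ‿cong (≈ᴹ-trans (+ᴹ-cross _ _ _ _) (+ᴹ-congˡ (+ᴹ-comm _ _)))) ⟩
        ((D (D′ X) · Y +ᴹ X · D (D′ Y)) +ᴹ (D′ X · D Y +ᴹ D X · D′ Y)) -ᴹ
        ((D′ (D X) · Y +ᴹ X · D′ (D Y)) +ᴹ (D′ X · D Y +ᴹ D X · D′ Y))
          ≈⟨ +ᴹ-cancelʳ-sub _ _ _ ⟩
        (D (D′ X) · Y +ᴹ X · D (D′ Y)) -ᴹ (D′ (D X) · Y +ᴹ X · D′ (D Y))
          ≈⟨ -ᴹ-interchange _ _ _ _ ⟩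
        (D (D′ X) · Y -ᴹ D′ (D X) · Y) +ᴹ (X · D (D′ Y) -ᴹ X · D′ (D Y))
          ≈⟨ +ᴹ-cong (LinearMapProperties.sub-homo (R-linear Y) _ _)
                     (LinearMapProperties.sub-homo (L-linear X) _ _) ⟨
        ⟦ D , D′ ⟧ X · Y +ᴹ X · ⟦ D , D′ ⟧ Y ∎
    }
    where
    module D = Derivation D-derivation
    module D′ = Derivation D′-derivation

  ⟦D,L⟧ : ∀ {D} → IsAlgDerivation A D → ∀ q X → ⟦ D , L q ⟧ X ≈ᴹ L (D q) X
  ⟦D,L⟧ {D} D-derivation q X = begin
    D (q · X) -ᴹ q · D X               ≈⟨ +ᴹ-congʳ (leibniz q X) ⟩
    (D q · X +ᴹ q · D X) -ᴹ q · D X    ≈⟨ +ᴹ-sub-cancelʳ _ _ ⟩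
    D q · X                            ∎
    where open IsAlgDerivation D-derivation

  ⟦L,L⟧ : ∀ p q X → ⟦ L p , L q ⟧ X ≈ᴹ L (p · q -ᴹ q · p) X
  ⟦L,L⟧ p q X = begin
    p · (q · X) -ᴹ q · (p · X)      ≈⟨ +ᴹ-cong (·-assoc p q X) (-ᴹ‿cong (·-assoc q p X)) ⟨
    (p · q) · X -ᴹ (q · p) · X      ≈⟨ LinearMapProperties.sub-homo (R-linear X) _ _ ⟨
    (p · q -ᴹ q · p) · X            ∎

  ⟦D⊕L,D⊕L⟧ : ∀ {D D′} → IsAlgDerivation A D → IsAlgDerivation A D′ → ∀ p q X →
            ⟦ D ⊕ L p , D′ ⊕ L q ⟧ X ≈ᴹ
            (⟦ D , D′ ⟧ ⊕ L ((D q -ᴹ D′ p) +ᴹ (p · q -ᴹ q · p))) X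
  ⟦D⊕L,D⊕L⟧ {D} {D′} D-derivation D′-derivation p q X = begin
    ⟦ D ⊕ L p , D′ ⊕ L q ⟧ X
      ≈⟨ ⟦⟧-distribʳ-⊕ (⊕-linear D′.linear (L-linear q)) D (L p) X ⟩
    ⟦ D , D′ ⊕ L q ⟧ X +ᴹ ⟦ L p , D′ ⊕ L q ⟧ X
      ≈⟨ +ᴹ-cong (⟦⟧-distribˡ-⊕ D.linear D′ (L q) X)
                 (⟦⟧-distribˡ-⊕ (L-linear p) D′ (L q) X) ⟩
    (⟦ D , D′ ⟧ X +ᴹ ⟦ D , L q ⟧ X) +ᴹ (⟦ L p , D′ ⟧ X +ᴹ ⟦ L p , L q ⟧ X)
      ≈⟨ ≈ᴹ-trans (+ᴹ-assoc _ _ _) (+ᴹ-congˡ (≈ᴹ-sym (+ᴹ-assoc _ _ _))) ⟩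
    ⟦ D , D′ ⟧ X +ᴹ ((⟦ D , L q ⟧ X +ᴹ ⟦ L p , D′ ⟧ X) +ᴹ ⟦ L p , L q ⟧ X)
      ≈⟨ +ᴹ-congˡ (+ᴹ-cong (+ᴹ-cong (⟦D,L⟧ D-derivation q X) mixed) (⟦L,L⟧ p q X)) ⟩
    ⟦ D , D′ ⟧ X +ᴹ ((D q · X -ᴹ D′ p · X) +ᴹ (p · q -ᴹ q · p) · X)
      ≈⟨ +ᴹ-congˡ (+ᴹ-congʳ (LinearMapProperties.sub-homo (R-linear X) _ _)) ⟨
    ⟦ D , D′ ⟧ X +ᴹ ((D q -ᴹ D′ p) · X +ᴹ (p · q -ᴹ q · p) · X)
      ≈⟨ +ᴹ-congˡ (·-+ˡ _ _ X) ⟨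
    ⟦ D , D′ ⟧ X +ᴹ ((D q -ᴹ D′ p) +ᴹ (p · q -ᴹ q · p)) · X ∎
    where
    module D = Derivation D-derivation
    module D′ = Derivation D′-derivation

    mixed : ⟦ L p , D′ ⟧ X ≈ᴹ -ᴹ (D′ p · X)
    mixed = ≈ᴹ-trans (⟦⟧-anticomm (L p) D′ X) (-ᴹ‿cong (⟦D,L⟧ D′-derivation p X))

  ⊕L-+ᴹ : ∀ D D′ p q X → ((D ⊕ D′) ⊕ L (p +ᴹ q)) X ≈ᴹ ((D ⊕ L p) ⊕ (D′ ⊕ L q)) X
  ⊕L-+ᴹ D D′ p q X = ≈ᴹ-trans (+ᴹ-congˡ (·-+ˡ p q X)) (+ᴹ-interchange _ _ _ _)

  ⊕L-*ₗ : ∀ c D p X → ((c ⊙ D) ⊕ L (c *ₗ p)) X ≈ᴹ (c ⊙ (D ⊕ L p)) X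
  ⊕L-*ₗ c D p X = ≈ᴹ-trans (+ᴹ-congˡ (·-*ˡ c p X)) (≈ᴹ-sym (*ₗ-distribˡ c _ _))

module UniversalEnvelopeProperties {K : CommutativeRing k ℓk} {𝔥 : LieAlgebra {K = K} n ℓn}
                                   (U : UniversalEnvelope 𝔥 a ℓa) where
  open UniversalEnvelope U
  open AssocAlgebraProperties algebra using (dualNumbers; graph-isAlgHom)

  derivation-unique : ∀ {D D′} → IsAlgDerivation algebra D → IsAlgDerivation algebra D′ →
                      (∀ v → D (ι v) ≈ᴹ D′ (ι v)) → ∀ X → D X ≈ᴹ D′ X
  derivation-unique D-derivation D′-derivation D≈D′ X =
    proj₂ (unique dualNumbers _ _ (graph-isAlgHom D-derivation) (graph-isAlgHom D′-derivation)
                  (λ v → ≈ᴹ-refl , D≈D′ v) X)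

module ExtendedDerivations {K : CommutativeRing k ℓk}
    {𝔤 : LieAlgebra {K = K} m ℓm} {𝔥 : LieAlgebra {K = K} n ℓn}
    {υ : LieAlgebra.Carrierᴹ 𝔤 → LieAlgebra.Carrierᴹ 𝔥 → LieAlgebra.Carrierᴹ 𝔥}
    (υ-morphism : IsLieMorphismToDer 𝔤 𝔥 υ)
    (U : UniversalEnvelope 𝔥 a ℓa)
    {ῡ : LieAlgebra.Carrierᴹ 𝔤 → UniversalEnvelope.Carrierᴹ U → UniversalEnvelope.Carrierᴹ U}
    (ῡ-derivation : ∀ x → IsAlgDerivation (UniversalEnvelope.algebra U) (ῡ x))
    (ῡ-extends : ∀ x v → UniversalEnvelope._≈ᴹ_ U (ῡ x (UniversalEnvelope.ι U v))
                                                   (UniversalEnvelope.ι U (υ x v)))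
    where
  private
    module G = LieAlgebra 𝔤
    module H = LieAlgebra 𝔥
    module υ = IsLieMorphismToDer υ-morphism
    module ι = IsLinear (UniversalEnvelope.ι-linear U)
  open UniversalEnvelope U
  open AssocAlgebraProperties algebra
  open Endomaps vectorSpace
  open UniversalEnvelopeProperties U
  open SetoidReasoning ≈ᴹ-setoid

  ῡ-cong : ∀ {x x′} → x G.≈ᴹ x′ → ∀ X → ῡ x X ≈ᴹ ῡ x′ X
  ῡ-cong {x} {x′} x≈x′ = derivation-unique (ῡ-derivation x) (ῡ-derivation x′) λ v → begin
    ῡ x (ι v)    ≈⟨ ῡ-extends x v ⟩
    ι (υ x v)    ≈⟨ ι.cong (υ.cong x≈x′ v) ⟩
    ι (υ x′ v)   ≈⟨ ῡ-extends x′ v ⟨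
    ῡ x′ (ι v)   ∎

  ῡ-+ᴹ : ∀ x y X → ῡ (x G.+ᴹ y) X ≈ᴹ (ῡ x ⊕ ῡ y) X
  ῡ-+ᴹ x y = derivation-unique (ῡ-derivation (x G.+ᴹ y))
    (⊕-derivation (ῡ-derivation x) (ῡ-derivation y)) λ v → begin
      ῡ (x G.+ᴹ y) (ι v)        ≈⟨ ῡ-extends (x G.+ᴹ y) v ⟩
      ι (υ (x G.+ᴹ y) v)        ≈⟨ ι.cong (υ.additive x y v) ⟩
      ι (υ x v H.+ᴹ υ y v)      ≈⟨ ι.additive _ _ ⟩
      ι (υ x v) +ᴹ ι (υ y v)    ≈⟨ +ᴹ-cong (ῡ-extends x v) (ῡ-extends y v) ⟨
      ῡ x (ι v) +ᴹ ῡ y (ι v)    ∎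

  ῡ-*ₗ : ∀ c x X → ῡ (c G.*ₗ x) X ≈ᴹ (c ⊙ ῡ x) X
  ῡ-*ₗ c x = derivation-unique (ῡ-derivation (c G.*ₗ x))
    (⊙-derivation c (ῡ-derivation x)) λ v → begin
      ῡ (c G.*ₗ x) (ι v)   ≈⟨ ῡ-extends (c G.*ₗ x) v ⟩
      ι (υ (c G.*ₗ x) v)   ≈⟨ ι.cong (υ.homogeneous c x v) ⟩
      ι (c H.*ₗ υ x v)     ≈⟨ ι.homogeneous c _ ⟩
      c *ₗ ι (υ x v)       ≈⟨ *ₗ-congˡ (ῡ-extends x v) ⟨
      c *ₗ ῡ x (ι v)       ∎

  ῡ-bracket : ∀ x y X → ῡ G.[ x , y ] X ≈ᴹ ⟦ ῡ x , ῡ y ⟧ X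
  ῡ-bracket x y = derivation-unique (ῡ-derivation G.[ x , y ])
    (⟦⟧-derivation (ῡ-derivation x) (ῡ-derivation y)) λ v → begin
      ῡ G.[ x , y ] (ι v)                        ≈⟨ ῡ-extends G.[ x , y ] v ⟩
      ι (υ G.[ x , y ] v)                        ≈⟨ ι.cong (υ.bracket x y v) ⟩
      ι (υ x (υ y v) H.-ᴹ υ y (υ x v))           ≈⟨ LinearMapProperties.sub-homo ι-linear _ _ ⟩
      ι (υ x (υ y v)) -ᴹ ι (υ y (υ x v))         ≈⟨ +ᴹ-cong (ῡ-ῡ-ι x y v) (-ᴹ‿cong (ῡ-ῡ-ι y x v)) ⟨
      ῡ x (ῡ y (ι v)) -ᴹ ῡ y (ῡ x (ι v))         ∎
    where
    ῡ-ῡ-ι : ∀ x y v → ῡ x (ῡ y (ι v)) ≈ᴹ ι (υ x (υ y v))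
    ῡ-ῡ-ι x y v = ≈ᴹ-trans (Derivation.cong (ῡ-derivation x) (ῡ-extends y v)) (ῡ-extends x _)

module CrossedMorphismImage {K : CommutativeRing k ℓk}
    {𝔤 : LieAlgebra {K = K} m ℓm} {𝔥 : LieAlgebra {K = K} n ℓn}
    {υ : LieAlgebra.Carrierᴹ 𝔤 → LieAlgebra.Carrierᴹ 𝔥 → LieAlgebra.Carrierᴹ 𝔥}
    {φ : LieAlgebra.Carrierᴹ 𝔤 → LieAlgebra.Carrierᴹ 𝔥}
    (φ-crossed : IsCrossedMorphism 𝔤 𝔥 υ φ)
    (U : UniversalEnvelope 𝔥 a ℓa)
    {ῡ : LieAlgebra.Carrierᴹ 𝔤 → UniversalEnvelope.Carrierᴹ U → UniversalEnvelope.Carrierᴹ U}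
    (ῡ-extends : ∀ x v → UniversalEnvelope._≈ᴹ_ U (ῡ x (UniversalEnvelope.ι U v))
                                                   (UniversalEnvelope.ι U (υ x v)))
    where
  private
    module G = LieAlgebra 𝔤
    module H = LieAlgebra 𝔥
    module φ = IsCrossedMorphism φ-crossed
    module ι = IsLinear (UniversalEnvelope.ι-linear U)
  open UniversalEnvelope U
  open SetoidReasoning ≈ᴹ-setoid

  ιφ-linear : IsLinear G.vectorSpace vectorSpace (λ x → ι (φ x))
  ιφ-linear = ∘-linear ι-linear φ.linear

  ιφ-bracket : ∀ x y → ι (φ G.[ x , y ]) ≈ᴹ
               (ῡ x (ι (φ y)) -ᴹ ῡ y (ι (φ x))) +ᴹ (ι (φ x) · ι (φ y) -ᴹ ι (φ y) · ι (φ x))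
  ιφ-bracket x y = begin
    ι (φ G.[ x , y ])
      ≈⟨ ι.cong (φ.crossed x y) ⟩
    ι (υ x (φ y) H.-ᴹ υ y (φ x) H.+ᴹ H.[ φ x , φ y ])
      ≈⟨ ι.additive _ _ ⟩
    ι (υ x (φ y) H.-ᴹ υ y (φ x)) +ᴹ ι H.[ φ x , φ y ]
      ≈⟨ +ᴹ-cong (LinearMapProperties.sub-homo ι-linear _ _) (ι-bracket (φ x) (φ y)) ⟩
    (ι (υ x (φ y)) -ᴹ ι (υ y (φ x))) +ᴹ (ι (φ x) · ι (φ y) -ᴹ ι (φ y) · ι (φ x))
      ≈⟨ +ᴹ-congʳ (+ᴹ-cong (ῡ-extends x (φ y)) (-ᴹ‿cong (ῡ-extends y (φ x)))) ⟨
    (ῡ x (ι (φ y)) -ᴹ ῡ y (ι (φ x))) +ᴹ (ι (φ x) · ι (φ y) -ᴹ ι (φ y) · ι (φ x)) ∎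

mainTheorem4 : ∀ {k ℓk m ℓm n ℓn a ℓa : Level}
    (K : CommutativeRing k ℓk) → IsFieldOfCharZero K →
    (𝔤 : LieAlgebra {K = K} m ℓm) (𝔥 : LieAlgebra {K = K} n ℓn)
    (υ : LieAlgebra.Carrierᴹ 𝔤 → LieAlgebra.Carrierᴹ 𝔥 → LieAlgebra.Carrierᴹ 𝔥) →
    IsLieMorphismToDer 𝔤 𝔥 υ →
    (φ : LieAlgebra.Carrierᴹ 𝔤 → LieAlgebra.Carrierᴹ 𝔥) →
    IsCrossedMorphism 𝔤 𝔥 υ φ →
    (U : UniversalEnvelope 𝔥 a ℓa) →
    (ῡ : LieAlgebra.Carrierᴹ 𝔤 → UniversalEnvelope.Carrierᴹ U → UniversalEnvelope.Carrierᴹ U) →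
    (∀ x → IsAlgDerivation (UniversalEnvelope.algebra U) (ῡ x)) →
    (∀ x v → UniversalEnvelope._≈ᴹ_ U (ῡ x (UniversalEnvelope.ι U v))
                                       (UniversalEnvelope.ι U (υ x v))) →
    IsLieModule 𝔤 (UniversalEnvelope.vectorSpace U) (M-action 𝔤 U φ ῡ)
mainTheorem4 K _ 𝔤 𝔥 υ υ-morphism φ φ-crossed U ῡ ῡ-derivation ῡ-extends = record
  { endo        = λ x → ⊕-linear (Derivation.linear (ῡ-derivation x)) (L-linear (ιφ x))
  ; cong        = λ x≈x′ X → +ᴹ-cong (ῡ-cong x≈x′ X) (·-cong (ιφ.cong x≈x′) ≈ᴹ-refl)
  ; additive    = λ x y X → ≈ᴹ-trans (+ᴹ-cong (ῡ-+ᴹ x y X) (·-cong (ιφ.additive x y) ≈ᴹ-refl))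
                                     (⊕L-+ᴹ (ῡ x) (ῡ y) (ιφ x) (ιφ y) X)
  ; homogeneous = λ c x X → ≈ᴹ-trans (+ᴹ-cong (ῡ-*ₗ c x X) (·-cong (ιφ.homogeneous c x) ≈ᴹ-refl))
                                     (⊕L-*ₗ c (ῡ x) (ιφ x) X)
  ; bracket     = λ x y X → ≈ᴹ-trans (+ᴹ-cong (ῡ-bracket x y X) (·-cong (ιφ-bracket x y) ≈ᴹ-refl))
                                     (≈ᴹ-sym (⟦D⊕L,D⊕L⟧ (ῡ-derivation x) (ῡ-derivation y)
                                                       (ιφ x) (ιφ y) X))
  }
  where
  open UniversalEnvelope U
  open AssocAlgebraProperties algebra
  open Endomaps vectorSpace
  open ExtendedDerivations υ-morphism U ῡ-derivation ῡ-extends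
  open CrossedMorphismImage φ-crossed U {ῡ} ῡ-extends
  module ιφ = IsLinear ιφ-linear

  ιφ : LieAlgebra.Carrierᴹ 𝔤 → Carrierᴹ
  ιφ x = ι (φ x)
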